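{- Let $G$ be a finite abelian group, $k$ a positive integer, and $S\subseteq G$ with $0\in S$ a $k$-separable subset. Let $A$ be a $k$-atom of $S$ with $0\in A$, and suppose $p\ge k$, where $p$ is the smallest prime divisor of $|G|$. Then either $A$ is a subgroup of $G$ or $|A\cap(x+A)|\le k-1$ for every $x\in G\setminus\{0\}$. In particular, when $k=2$, $A$ is either a subgroup or a Sidon set.
   Context: For $S\subseteq G$ with $0\in S$, $\langle S\rangle$ is the subgroup generated by $S$. $S$ is $k$-separable if there exists $X\subseteq\langle S\rangle$ with $|X|\ge k$ and $|X+S|\le|\langle S\rangle|-k$; then $\kappa_k(S)=\min\{|X+S|-|X| : X\subseteq\langle S\rangle,\ |X|\ge k,\ |X+S|\le|\langle S\rangle|-k\}$. A set attaining this minimum is a $k$-fragment; a $k$-fragment of minimum cardinality is a $k$-atom. A Sidon set is a set $X$ in which no two distinct unordered pairs of (not necessarily distinct) elements have the same sum. -}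

module Defs where

open import Level using (0ℓ)
open import Data.Bool using (Bool; true; false; T; _∧_; if_then_else_)
open import Data.Nat using (ℕ; zero; suc; _+_; _∸_; _≤_)
open import Data.List using (List; []; _∷_)
open import Data.Bool.ListAction using (any)
open import Data.List.Membership.Propositional using (_∈_)
open import Data.List.Relation.Unary.Unique.Propositional using (Unique)
open import Data.Product using (Σ; _×_; _,_)
open import Data.Sum using (_⊎_)
open import Relation.Nullary using (¬_)
open import Relation.Nullary.Decidable using (⌊_⌋)
open import Relation.Binary.PropositionalEquality using (_≡_)
open import Relation.Binary.Definitions using (DecidableEquality)
open import Algebra.Structures using (IsAbelianGroup)

record FiniteAbelianGroup : Set₁ where
  field
    Carrier        : Set
    _⊕_            : Carrier → Carrier → Carrier
    𝟘              : Carrier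
    ⊖_             : Carrier → Carrier
    isAbelianGroup : IsAbelianGroup _≡_ _⊕_ 𝟘 ⊖_
    _≟_            : DecidableEquality Carrier
    elements       : List Carrier
    complete       : ∀ x → x ∈ elements
    unique         : Unique elements

module _ (G : FiniteAbelianGroup) where
  open FiniteAbelianGroup G

  Subset : Set
  Subset = Carrier → Bool

  _∈ₛ_ : Carrier → Subset → Set
  g ∈ₛ X = T (X g)

  _⊆_ : Subset → Subset → Set
  X ⊆ Y = ∀ g → g ∈ₛ X → g ∈ₛ Y

  countIn : List Carrier → Subset → ℕ
  countIn []       X = 0
  countIn (x ∷ xs) X = (if X x then 1 else 0) + countIn xs X

  ∣_∣ : Subset → ℕ
  ∣ X ∣ = countIn elements X

  order : ℕ
  order = ∣ (λ _ → true) ∣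

  _+ₛ_ : Subset → Subset → Subset
  (X +ₛ S) g = any (λ x → any (λ s → X x ∧ S s ∧ ⌊ g ≟ (x ⊕ s) ⌋) elements) elements

  _+ₜ_ : Carrier → Subset → Subset
  (x +ₜ A) g = any (λ a → A a ∧ ⌊ g ≟ (x ⊕ a) ⌋) elements

  _∩_ : Subset → Subset → Subset
  (X ∩ Y) g = X g ∧ Y g

  IsSubgroup : Subset → Set
  IsSubgroup H = (𝟘 ∈ₛ H)
               × (∀ x y → x ∈ₛ H → y ∈ₛ H → (x ⊕ y) ∈ₛ H)
               × (∀ x → x ∈ₛ H → (⊖ x) ∈ₛ H)

  IsGeneratedBy : Subset → Subset → Set
  IsGeneratedBy S H = IsSubgroup H × S ⊆ H
                    × (∀ K → IsSubgroup K → S ⊆ K → H ⊆ K)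

  -- admissible sets in the definition of κ_k(S), where H = ⟨S⟩:
  -- X ⊆ ⟨S⟩, |X| ≥ k, |X + S| ≤ |⟨S⟩| - k
  Admissible : ℕ → Subset → Subset → Subset → Set
  Admissible k S H X = X ⊆ H × k ≤ ∣ X ∣ × ∣ X +ₛ S ∣ + k ≤ ∣ H ∣

  IsSeparable : ℕ → Subset → Subset → Set
  IsSeparable k S H = Σ Subset (Admissible k S H)

  IsFragment : ℕ → Subset → Subset → Subset → Set
  IsFragment k S H X = Admissible k S H X
                     × (∀ Y → Admissible k S H Y → ∣ X +ₛ S ∣ ∸ ∣ X ∣ ≤ ∣ Y +ₛ S ∣ ∸ ∣ Y ∣)

  IsAtom : ℕ → Subset → Subset → Subset → Set
  IsAtom k S H X = IsFragment k S H X × (∀ Y → IsFragment k S H Y → ∣ X ∣ ≤ ∣ Y ∣)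

  IsSidon : Subset → Set
  IsSidon X = ∀ a b c d → a ∈ₛ X → b ∈ₛ X → c ∈ₛ X → d ∈ₛ X →
              (a ⊕ b) ≡ (c ⊕ d) → (a ≡ c × b ≡ d) ⊎ (a ≡ d × b ≡ c)

{-# OPTIONS --safe #-}
-- Write H = ⟨S⟩ and κ X = |X + S| − |X|. Since 0 ∈ S, κ is submodular,
-- κ (X ∩ Y) + κ (X ∪ Y) ≤ κ X + κ Y, and translation invariant. The set −(H ∖ (A + S))
-- is admissible with κ at most κ A, so minimality of an atom A gives |A| + |A + S| ≤ |H|.
-- If |A ∩ (y + A)| ≥ k, this bound makes A ∪ (y + A) admissible; submodularity then turns
-- A ∩ (y + A) into a fragment, and minimality of A forces A = y + A.
-- Given x ≠ 0 with |A ∩ (x + A)| ≥ k, A is thus stable under adding multiples of x, and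
-- the order of x is at least p ≥ k since it divides |G| (Lagrange, via x-periodic sets).
-- Hence for a ∈ A the k distinct points j x + a, j < k, lie in A ∩ (a + A), so A = a + A
-- for every a ∈ A: A is a subgroup. For k = 2, a + b = c + d with {a, b} ≠ {c, d} would
-- put the two points a ≠ d into A ∩ ((a − c) + A).
module Submission where

import Defs
open import Level using (0ℓ)
open import Algebra.Bundles using (AbelianGroup)
import Algebra.Properties.AbelianGroup as AbelianGroupProperties
import Algebra.Properties.Monoid.Mult as MonoidMultiplication
open import Data.Bool using (Bool; true; false; T; _∧_; _∨_; not; if_then_else_)
open import Data.Bool.Properties using (T-∧; T-∨; T-not-≡; ∧-identityʳ)
open import Data.Bool.ListAction using (any)
open import Data.Empty using (⊥-elim)
open import Data.List using (List; []; _∷_; [_]; length; map; applyUpTo)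
open import Data.List.Membership.Propositional using (_∈_; lose; find)
open import Data.List.Membership.Propositional.Properties using (∈-applyUpTo⁺; ∈-applyUpTo⁻)
open import Data.List.Properties using (length-applyUpTo)
import Data.List.Relation.Unary.All as All
open import Data.List.Relation.Unary.All using ([]; _∷_)
import Data.List.Relation.Unary.Any as Any
open import Data.List.Relation.Unary.Any using (here; there; any?; satisfied)
open import Data.List.Relation.Unary.Any.Properties using (any⁺; any⁻)
open import Data.List.Relation.Unary.Unique.Propositional using (Unique; []; _∷_)
import Data.List.Relation.Unary.Unique.Propositional.Properties as Unique
open import Data.Nat using (ℕ; zero; suc; _+_; _∸_; _≤_; _<_; _≥_; z≤n; s≤s; _≤?_; _<?_)
open import Data.Nat.Divisibility using (_∣_; _∣0; ∣-refl; ∣-trans; ∣m∣n⇒∣m+n; m∣m*n; ∣⇒≤)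
open import Data.Nat.Induction using (<-rec)
open import Data.Nat.ListAction using (product)
open import Data.Nat.Primality using (Prime)
open import Data.Nat.Primality.Factorisation using (factorise)
import Data.Nat.Properties as ℕ
open import Data.Nat.Properties using (≤-refl; ≤-trans; module ≤-Reasoning)
open import Algebra.Properties.CommutativeSemigroup ℕ.+-commutativeSemigroup using (interchange; x∙yz≈y∙xz)
open import Data.Product using (∃; ∃-syntax; ∃₂; _×_; _,_; proj₁; proj₂)
import Data.Sum as Sum
open import Data.Sum using (_⊎_; inj₁; inj₂; [_,_]′)
open import Function using (_∘_; Equivalence)
open import Function.Definitions using (Injective)
open import Relation.Nullary using (¬_; yes; no)
open import Relation.Nullary.Decidable using (_×-dec_; ¬?; ⌊_⌋; toWitness; fromWitness; T?; dec-false)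
open import Relation.Unary using (Decidable)
open import Relation.Binary.PropositionalEquality
  using (_≡_; _≢_; refl; sym; trans; cong; cong₂; subst; module ≡-Reasoning)

open Equivalence using (to; from)

a≤m∧m+n≤a+a⇒n≤a : ∀ {a m n} → a ≤ m → m + n ≤ a + a → n ≤ a
a≤m∧m+n≤a+a⇒n≤a {a} {m} {n} a≤m m+n≤a+a = ℕ.+-cancelˡ-≤ a n a (≤-trans (ℕ.+-monoˡ-≤ n a≤m) m+n≤a+a)

prime-divisor : ∀ m → 2 ≤ m → ∃[ q ] Prime q × q ∣ m
prime-divisor (suc zero) (s≤s ())
prime-divisor m@(suc (suc _)) _ with factorise m
... | record { factors = q ∷ qs ; isFactorisation = m≡q*Πqs ; factorsPrime = q-prime ∷ _ } =
  q , q-prime , subst (q ∣_) (sym m≡q*Πqs) (m∣m*n (product qs))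

least-prime-divisor≤ : ∀ {p n m} → (∀ q → Prime q → q ∣ n → p ≤ q) → 2 ≤ m → m ∣ n → p ≤ m
least-prime-divisor≤ {m = m@(suc _)} p-least 2≤m m∣n with q , q-prime , q∣m ← prime-divisor m 2≤m =
  ≤-trans (p-least q q-prime (∣-trans q∣m m∣n)) (∣⇒≤ q∣m)

module Properties (G : Defs.FiniteAbelianGroup) where
  open Defs.FiniteAbelianGroup G

  Subset : Set
  Subset = Defs.Subset G

  _∈ₛ_ : Carrier → Subset → Set
  _∈ₛ_ = Defs._∈ₛ_ G

  _⊆_ : Subset → Subset → Set
  _⊆_ = Defs._⊆_ G

  ∣_∣ : Subset → ℕ
  ∣_∣ = Defs.∣_∣ G

  _+ₛ_ : Subset → Subset → Subset
  _+ₛ_ = Defs._+ₛ_ G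

  _+ₜ_ : Carrier → Subset → Subset
  _+ₜ_ = Defs._+ₜ_ G

  _∩_ : Subset → Subset → Subset
  _∩_ = Defs._∩_ G

  order : ℕ
  order = Defs.order G

  IsSubgroup : Subset → Set
  IsSubgroup = Defs.IsSubgroup G

  Admissible IsFragment IsAtom : ℕ → Subset → Subset → Subset → Set
  Admissible = Defs.Admissible G
  IsFragment = Defs.IsFragment G
  IsAtom = Defs.IsAtom G

  IsSidon : Subset → Set
  IsSidon = Defs.IsSidon G

  countIn : List Carrier → Subset → ℕ
  countIn = Defs.countIn G

  abelianGroup : AbelianGroup 0ℓ 0ℓ
  abelianGroup = record
    { Carrier = Carrier ; _≈_ = _≡_ ; _∙_ = _⊕_ ; ε = 𝟘 ; _⁻¹ = ⊖_ ; isAbelianGroup = isAbelianGroup }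

  open AbelianGroup abelianGroup using (assoc; comm; identityˡ; identityʳ; monoid)
  open AbelianGroupProperties abelianGroup
  open MonoidMultiplication monoid using (×-homo-+) renaming (_×_ to _·_)

  ∅ : Subset
  ∅ _ = false

  _∪_ : Subset → Subset → Subset
  (X ∪ Y) g = X g ∨ Y g

  _∖_ : Subset → Subset → Subset
  (X ∖ Y) g = X g ∧ not (Y g)

  ⊖ₛ_ : Subset → Subset
  (⊖ₛ X) g = X (⊖ g)

  ⟦_⟧ : List Carrier → Subset
  ⟦ L ⟧ g = any (λ h → ⌊ g ≟ h ⌋) L

  ∈-⟦⟧⁺ : ∀ {L g} → g ∈ L → g ∈ₛ ⟦ L ⟧
  ∈-⟦⟧⁺ g∈L = any⁺ _ (Any.map fromWitness g∈L)

  ∈-⟦⟧⁻ : ∀ L {g} → g ∈ₛ ⟦ L ⟧ → g ∈ L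
  ∈-⟦⟧⁻ L g∈⟦L⟧ = Any.map toWitness (any⁻ _ L g∈⟦L⟧)

  ∈-+ₜ⁺ : ∀ {A} y {a} → a ∈ₛ A → (y ⊕ a) ∈ₛ (y +ₜ A)
  ∈-+ₜ⁺ y {a} a∈A = any⁺ _ (lose (complete a) (from T-∧ (a∈A , fromWitness refl)))

  ∈-+ₜ⁻ : ∀ A y {g} → g ∈ₛ (y +ₜ A) → ∃[ a ] a ∈ₛ A × g ≡ y ⊕ a
  ∈-+ₜ⁻ A y g∈y+A with a , _ , a∈A∧g≡y+a ← find (any⁻ _ elements g∈y+A)
    with a∈A , g≡y+a ← to T-∧ a∈A∧g≡y+a = a , a∈A , toWitness g≡y+a

  ∈-+ₛ⁺ : ∀ {X S x s} → x ∈ₛ X → s ∈ₛ S → (x ⊕ s) ∈ₛ (X +ₛ S)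
  ∈-+ₛ⁺ {x = x} {s} x∈X s∈S =
    any⁺ _ (lose (complete x) (any⁺ _ (lose (complete s)
      (from T-∧ (x∈X , from T-∧ (s∈S , fromWitness refl))))))

  ∈-+ₛ⁻ : ∀ X S {g} → g ∈ₛ (X +ₛ S) → ∃₂ λ x s → x ∈ₛ X × s ∈ₛ S × g ≡ x ⊕ s
  ∈-+ₛ⁻ X S g∈X+S with x , _ , p ← find (any⁻ _ elements g∈X+S)
    with s , _ , q ← find (any⁻ _ elements p)
    with x∈X , r ← to T-∧ q
    with s∈S , g≡x+s ← to T-∧ r = x , s , x∈X , s∈S , toWitness g≡x+s

  ∈-∪⁺ˡ : ∀ {X Y g} → g ∈ₛ X → g ∈ₛ (X ∪ Y)
  ∈-∪⁺ˡ g∈X = from T-∨ (inj₁ g∈X)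

  ∈-∪⁺ʳ : ∀ {X Y g} → g ∈ₛ Y → g ∈ₛ (X ∪ Y)
  ∈-∪⁺ʳ {X} {g = g} g∈Y = from (T-∨ {X g}) (inj₂ g∈Y)

  ∈-∪⁻ : ∀ X Y {g} → g ∈ₛ (X ∪ Y) → g ∈ₛ X ⊎ g ∈ₛ Y
  ∈-∪⁻ X Y = to T-∨

  ∈-∩⁺ : ∀ {X Y g} → g ∈ₛ X → g ∈ₛ Y → g ∈ₛ (X ∩ Y)
  ∈-∩⁺ g∈X g∈Y = from T-∧ (g∈X , g∈Y)

  ∈-∩⁻ : ∀ X Y {g} → g ∈ₛ (X ∩ Y) → g ∈ₛ X × g ∈ₛ Y
  ∈-∩⁻ X Y = to T-∧

  ∈-∖⁺ : ∀ {X Y g} → g ∈ₛ X → ¬ g ∈ₛ Y → g ∈ₛ (X ∖ Y)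
  ∈-∖⁺ {Y = Y} {g} g∈X g∉Y = from T-∧ (g∈X , from T-not-≡ (dec-false (T? (Y g)) g∉Y))

  ∈-∖⁻ : ∀ X Y {g} → g ∈ₛ (X ∖ Y) → g ∈ₛ X × ¬ g ∈ₛ Y
  ∈-∖⁻ X Y g∈X∖Y with g∈X , g∉Y ← to T-∧ g∈X∖Y = g∈X , λ g∈Y → subst T (to T-not-≡ g∉Y) g∈Y

  -- Cardinalities of subsets

  search : ∀ {P : Carrier → Set} → Decidable P → ∃ P ⊎ (∀ g → ¬ P g)
  search P? with any? P? elements
  ... | yes some = inj₁ (satisfied some)
  ... | no none = inj₂ (λ g Pg → none (lose (complete g) Pg))

  𝟙 : Bool → ℕ
  𝟙 b = if b then 1 else 0

  𝟙-mono : ∀ {b c} → (T b → T c) → 𝟙 b ≤ 𝟙 c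
  𝟙-mono {false} _ = z≤n
  𝟙-mono {true} {true} _ = ≤-refl
  𝟙-mono {true} {false} b⇒c = ⊥-elim (b⇒c _)

  countIn-mono : ∀ L {X Y} → X ⊆ Y → countIn L X ≤ countIn L Y
  countIn-mono [] _ = z≤n
  countIn-mono (a ∷ L) X⊆Y = ℕ.+-mono-≤ (𝟙-mono (X⊆Y a)) (countIn-mono L X⊆Y)

  countIn-pointwise : ∀ L {X Y Z W} → (∀ g → 𝟙 (X g) + 𝟙 (Y g) ≡ 𝟙 (Z g) + 𝟙 (W g)) →
                      countIn L X + countIn L Y ≡ countIn L Z + countIn L W
  countIn-pointwise [] _ = refl
  countIn-pointwise (a ∷ L) {X} {Y} {Z} {W} eq = begin
    (𝟙 (X a) + countIn L X) + (𝟙 (Y a) + countIn L Y)  ≡⟨ interchange (𝟙 (X a)) _ _ _ ⟩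
    (𝟙 (X a) + 𝟙 (Y a)) + (countIn L X + countIn L Y)  ≡⟨ cong₂ _+_ (eq a) (countIn-pointwise L eq) ⟩
    (𝟙 (Z a) + 𝟙 (W a)) + (countIn L Z + countIn L W)  ≡⟨ interchange (𝟙 (Z a)) _ _ _ ⟩
    (𝟙 (Z a) + countIn L Z) + (𝟙 (W a) + countIn L W)  ∎
    where open ≡-Reasoning

  countIn-cong : ∀ L {X Y} → (∀ {g} → g ∈ L → X g ≡ Y g) → countIn L X ≡ countIn L Y
  countIn-cong [] _ = refl
  countIn-cong (a ∷ L) X≗Y = cong₂ _+_ (cong 𝟙 (X≗Y (here refl))) (countIn-cong L (X≗Y ∘ there))

  countIn-∅ : ∀ L → countIn L ∅ ≡ 0
  countIn-∅ [] = refl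
  countIn-∅ (_ ∷ L) = countIn-∅ L

  countIn-map : ∀ L (f : Carrier → Carrier) Y → countIn L (Y ∘ f) ≡ countIn (map f L) Y
  countIn-map [] f Y = refl
  countIn-map (a ∷ L) f Y = cong (𝟙 (Y (f a)) +_) (countIn-map L f Y)

  countIn-≤length : ∀ L X → countIn L X ≤ length L
  countIn-≤length [] X = z≤n
  countIn-≤length (a ∷ L) X = ℕ.+-mono-≤ (𝟙-mono {X a} {true} _) (countIn-≤length L X)

  countIn-length : ∀ L X → (∀ {g} → g ∈ L → g ∈ₛ X) → countIn L X ≡ length L
  countIn-length [] X _ = refl
  countIn-length (a ∷ L) X L⊆X with true ← X a | _ ← L⊆X (here refl) =
    cong suc (countIn-length L X (L⊆X ∘ there))

  countIn-strict : ∀ L {X Y a} → X ⊆ Y → a ∈ L → a ∈ₛ Y → ¬ a ∈ₛ X → suc (countIn L X) ≤ countIn L Y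
  countIn-strict (b ∷ L) {X} {Y} X⊆Y (here refl) a∈Y a∉X with X b | Y b
  ... | true  | _    = ⊥-elim (a∉X _)
  ... | false | true = s≤s (countIn-mono L X⊆Y)
  countIn-strict (b ∷ L) {X} {Y} X⊆Y (there a∈L) a∈Y a∉X = begin
    suc (𝟙 (X b) + countIn L X)  ≡⟨ ℕ.+-suc (𝟙 (X b)) _ ⟨
    𝟙 (X b) + suc (countIn L X)  ≤⟨ ℕ.+-mono-≤ (𝟙-mono (X⊆Y b)) (countIn-strict L X⊆Y a∈L a∈Y a∉X) ⟩
    𝟙 (Y b) + countIn L Y        ∎
    where open ≤-Reasoning

  countIn-unique : ∀ {L L′} X → Unique L → (∀ {g} → g ∈ L → g ∈ₛ X → g ∈ L′) →
                   countIn L X ≤ countIn L′ X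
  countIn-unique {[]} _ _ _ = z≤n
  countIn-unique {a ∷ L} {L′} X (a∉L ∷ L-unique) L⊆L′ with X a in Xa≡true
  ... | false = countIn-unique X L-unique (L⊆L′ ∘ there)
  ... | true = begin
    suc (countIn L X)         ≡⟨ cong suc (countIn-cong L (sym ∘ X∖a≗X)) ⟩
    suc (countIn L X∖a)       ≤⟨ s≤s (countIn-unique X∖a L-unique L∩X∖a⊆L′) ⟩
    suc (countIn L′ X∖a)      ≤⟨ countIn-strict L′ X∖a⊆X (L⊆L′ (here refl) a∈X) a∈X a∉X∖a ⟩
    countIn L′ X              ∎
    where
      open ≤-Reasoning
      X∖a : Subset
      X∖a = X ∖ ⟦ [ a ] ⟧
      X∖a⊆X : X∖a ⊆ X
      X∖a⊆X _ = proj₁ ∘ ∈-∖⁻ X ⟦ [ a ] ⟧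
      a∈X : a ∈ₛ X
      a∈X = subst T (sym Xa≡true) _
      a∉X∖a : ¬ a ∈ₛ X∖a
      a∉X∖a a∈X∖a = proj₂ (∈-∖⁻ X ⟦ [ a ] ⟧ a∈X∖a) (∈-⟦⟧⁺ {[ a ]} (here refl))
      X∖a≗X : ∀ {g} → g ∈ L → X∖a g ≡ X g
      X∖a≗X {g} g∈L with g ≟ a
      ... | yes refl = ⊥-elim (All.lookup a∉L g∈L refl)
      ... | no _ = ∧-identityʳ (X g)
      L∩X∖a⊆L′ : ∀ {g} → g ∈ L → g ∈ₛ X∖a → g ∈ L′
      L∩X∖a⊆L′ {g} g∈L = L⊆L′ (there g∈L) ∘ X∖a⊆X g

  ∣∣-mono : ∀ {X Y} → X ⊆ Y → ∣ X ∣ ≤ ∣ Y ∣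
  ∣∣-mono = countIn-mono elements

  ∣∣-empty : ∀ {X} → (∀ g → ¬ g ∈ₛ X) → ∣ X ∣ ≡ 0
  ∣∣-empty {X} X-empty = ℕ.n≤0⇒n≡0 (begin
    ∣ X ∣  ≤⟨ ∣∣-mono (λ g g∈X → ⊥-elim (X-empty g g∈X)) ⟩
    ∣ ∅ ∣  ≡⟨ countIn-∅ elements ⟩
    0      ∎)
    where open ≤-Reasoning

  ∣∣>0⇒nonempty : ∀ {X} → 0 < ∣ X ∣ → ∃ (_∈ₛ X)
  ∣∣>0⇒nonempty {X} ∣X∣>0 with search (T? ∘ X)
  ... | inj₁ nonempty = nonempty
  ... | inj₂ empty = ⊥-elim (ℕ.<-irrefl (sym (∣∣-empty empty)) ∣X∣>0)

  ∣∩∣+∣∪∣ : ∀ X Y → ∣ X ∩ Y ∣ + ∣ X ∪ Y ∣ ≡ ∣ X ∣ + ∣ Y ∣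
  ∣∩∣+∣∪∣ X Y = countIn-pointwise elements (λ g → 𝟙-∧-∨ (X g) (Y g))
    where
      𝟙-∧-∨ : ∀ b c → 𝟙 (b ∧ c) + 𝟙 (b ∨ c) ≡ 𝟙 b + 𝟙 c
      𝟙-∧-∨ false _     = refl
      𝟙-∧-∨ true  false = refl
      𝟙-∧-∨ true  true  = refl

  ∣∖∣+∣∩∣ : ∀ X Y → ∣ X ∖ Y ∣ + ∣ X ∩ Y ∣ ≡ ∣ X ∣
  ∣∖∣+∣∩∣ X Y = begin
    ∣ X ∖ Y ∣ + ∣ X ∩ Y ∣  ≡⟨ countIn-pointwise elements (λ g → 𝟙-split (X g) (Y g)) ⟩
    ∣ X ∣ + ∣ ∅ ∣          ≡⟨ cong (∣ X ∣ +_) (countIn-∅ elements) ⟩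
    ∣ X ∣ + 0              ≡⟨ ℕ.+-identityʳ ∣ X ∣ ⟩
    ∣ X ∣                  ∎
    where
      open ≡-Reasoning
      𝟙-split : ∀ b c → 𝟙 (b ∧ not c) + 𝟙 (b ∧ c) ≡ 𝟙 b + 0
      𝟙-split false _     = refl
      𝟙-split true  false = refl
      𝟙-split true  true  = refl

  ∣∣-disjoint : ∀ {X Y Z} → X ⊆ Z → Y ⊆ Z → (∀ g → g ∈ₛ X → ¬ g ∈ₛ Y) → ∣ X ∣ + ∣ Y ∣ ≤ ∣ Z ∣
  ∣∣-disjoint {X} {Y} {Z} X⊆Z Y⊆Z disjoint = begin
    ∣ X ∣ + ∣ Y ∣          ≡⟨ ∣∩∣+∣∪∣ X Y ⟨
    ∣ X ∩ Y ∣ + ∣ X ∪ Y ∣  ≡⟨ cong (_+ ∣ X ∪ Y ∣) (∣∣-empty X∩Y-empty) ⟩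
    ∣ X ∪ Y ∣              ≤⟨ ∣∣-mono X∪Y⊆Z ⟩
    ∣ Z ∣                  ∎
    where
      open ≤-Reasoning
      X∩Y-empty : ∀ g → ¬ g ∈ₛ (X ∩ Y)
      X∩Y-empty g g∈X∩Y = let g∈X , g∈Y = ∈-∩⁻ X Y g∈X∩Y in disjoint g g∈X g∈Y
      X∪Y⊆Z : (X ∪ Y) ⊆ Z
      X∪Y⊆Z g g∈X∪Y = [ X⊆Z g , Y⊆Z g ]′ (∈-∪⁻ X Y g∈X∪Y)

  ∣∣-injection : ∀ {X Y} (f : Carrier → Carrier) → Injective _≡_ _≡_ f →
                 (∀ {g} → g ∈ₛ X → f g ∈ₛ Y) → ∣ X ∣ ≤ ∣ Y ∣
  ∣∣-injection {X} {Y} f f-injective f[X]⊆Y = begin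
    ∣ X ∣                       ≤⟨ countIn-mono elements (λ _ → f[X]⊆Y) ⟩
    countIn elements (Y ∘ f)    ≡⟨ countIn-map elements f Y ⟩
    countIn (map f elements) Y  ≤⟨ countIn-unique Y (Unique.map⁺ f-injective unique) (λ _ _ → complete _) ⟩
    ∣ Y ∣                       ∎
    where open ≤-Reasoning

  length≤∣∣ : ∀ {L X} → Unique L → (∀ {g} → g ∈ L → g ∈ₛ X) → length L ≤ ∣ X ∣
  length≤∣∣ {L} {X} L-unique L⊆X = begin
    length L      ≡⟨ countIn-length L X L⊆X ⟨
    countIn L X   ≤⟨ countIn-unique X L-unique (λ {g} _ _ → complete g) ⟩
    ∣ X ∣         ∎
    where open ≤-Reasoning

  ∣⟦⟧∣ : ∀ {L} → Unique L → ∣ ⟦ L ⟧ ∣ ≡ length L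
  ∣⟦⟧∣ {L} L-unique = ℕ.≤-antisym
    (≤-trans (countIn-unique ⟦ L ⟧ unique (λ _ → ∈-⟦⟧⁻ L)) (countIn-≤length L ⟦ L ⟧))
    (length≤∣∣ L-unique ∈-⟦⟧⁺)

  ⊆∧∣∣≤⇒⊇ : ∀ {X Y} → X ⊆ Y → ∣ Y ∣ ≤ ∣ X ∣ → Y ⊆ X
  ⊆∧∣∣≤⇒⊇ {X} X⊆Y ∣Y∣≤∣X∣ g g∈Y with T? (X g)
  ... | yes g∈X = g∈X
  ... | no g∉X = ⊥-elim (ℕ.<⇒≱ (countIn-strict elements X⊆Y (complete g) g∈Y g∉X) ∣Y∣≤∣X∣)

  ∣∣-translate : ∀ {X Y} y → (∀ {g} → g ∈ₛ X → (y ⊕ g) ∈ₛ Y) →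
                 (∀ {g} → g ∈ₛ Y → ((⊖ y) ⊕ g) ∈ₛ X) → ∣ X ∣ ≡ ∣ Y ∣
  ∣∣-translate y y+X⊆Y -y+Y⊆X = ℕ.≤-antisym
    (∣∣-injection (y ⊕_) (∙-cancelˡ y _ _) y+X⊆Y)
    (∣∣-injection ((⊖ y) ⊕_) (∙-cancelˡ (⊖ y) _ _) -y+Y⊆X)

  ∣⊖ₛ∣ : ∀ X → ∣ ⊖ₛ X ∣ ≡ ∣ X ∣
  ∣⊖ₛ∣ X = ℕ.≤-antisym
    (∣∣-injection ⊖_ ⁻¹-injective (λ g∈⊖X → g∈⊖X))
    (∣∣-injection ⊖_ ⁻¹-injective (λ {g} g∈X → subst (T ∘ X) (sym (⁻¹-involutive g)) g∈X))

  ∣+ₜ∣ : ∀ y X → ∣ y +ₜ X ∣ ≡ ∣ X ∣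
  ∣+ₜ∣ y X = sym (∣∣-translate y (∈-+ₜ⁺ y) -y+[y+X]⊆X)
    where
      -y+[y+X]⊆X : ∀ {g} → g ∈ₛ (y +ₜ X) → ((⊖ y) ⊕ g) ∈ₛ X
      -y+[y+X]⊆X g∈y+X with a , a∈X , refl ← ∈-+ₜ⁻ X y g∈y+X =
        subst (T ∘ X) (sym (\\-leftDividesʳ y a)) a∈X

  -- Multiples, orders and Lagrange's theorem for cyclic subgroups

  Periodic : Carrier → Subset → Set
  Periodic x X = ∀ {g} → g ∈ₛ X → (x ⊕ g) ∈ₛ X

  Periodic-· : ∀ {x X} → Periodic x X → ∀ j → Periodic (j · x) X
  Periodic-· {X = X} _ zero {g} g∈X = subst (T ∘ X) (sym (identityˡ g)) g∈X
  Periodic-· {x} {X} x-periodic (suc j) {g} g∈X =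
    subst (T ∘ X) (sym (assoc x (j · x) g)) (x-periodic (Periodic-· {X = X} x-periodic j g∈X))

  OrderAtLeast : ℕ → Carrier → Set
  OrderAtLeast n x = ∀ {j} → 0 < j → j < n → j · x ≢ 𝟘

  HasOrder : ℕ → Carrier → Set
  HasOrder d x = 0 < d × d · x ≡ 𝟘 × OrderAtLeast d x

  ·-distinct : ∀ {n x i j} → OrderAtLeast n x → i < j → j < n → i · x ≢ j · x
  ·-distinct {n} {x} {i} {j} x-order≥n i<j j<n i·x≡j·x =
    x-order≥n (ℕ.m<n⇒0<n∸m i<j) (ℕ.≤-<-trans (ℕ.m∸n≤m j i) j<n)
      (identityˡ-unique ((j ∸ i) · x) (i · x) (begin
        ((j ∸ i) · x) ⊕ (i · x)  ≡⟨ ×-homo-+ x (j ∸ i) i ⟨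
        (j ∸ i + i) · x          ≡⟨ cong (_· x) (ℕ.m∸n+n≡m (ℕ.<⇒≤ i<j)) ⟩
        j · x                    ≡⟨ i·x≡j·x ⟨
        i · x                    ∎))
    where open ≡-Reasoning

  order-exists : ∀ x m → 0 < m → m · x ≡ 𝟘 → ∃[ d ] d ≤ m × HasOrder d x
  order-exists x = <-rec _ least-below
    where
      least-below : ∀ m → (∀ {j} → j < m → 0 < j → j · x ≡ 𝟘 → ∃[ d ] d ≤ j × HasOrder d x) →
                    0 < m → m · x ≡ 𝟘 → ∃[ d ] d ≤ m × HasOrder d x
      least-below m below 0<m m·x≡0 with ℕ.anyUpTo? (λ j → 0 <? j ×-dec (j · x) ≟ 𝟘) m
      ... | yes (j , j<m , 0<j , j·x≡0) with d , d≤j , x-order ← below j<m 0<j j·x≡0 =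
        d , ≤-trans d≤j (ℕ.<⇒≤ j<m) , x-order
      ... | no none = m , ≤-refl , 0<m , m·x≡0 , λ 0<j j<m j·x≡0 → none (_ , j<m , 0<j , j·x≡0)

  orbit : Carrier → ℕ → Carrier → List Carrier
  orbit x n y = applyUpTo (λ j → (j · x) ⊕ y) n

  orbit-unique : ∀ {x n} y → OrderAtLeast n x → Unique (orbit x n y)
  orbit-unique {x} {n} y x-order≥n =
    Unique.applyUpTo⁺₁ _ n (λ i<j j<n → ·-distinct x-order≥n i<j j<n ∘ ∙-cancelʳ y _ _)

  orbit-periodic : ∀ {d x} y → HasOrder d x → Periodic x ⟦ orbit x d y ⟧
  orbit-periodic {d} {x} y (0<d , d·x≡0 , _) g∈O
    with j , j<d , refl ← ∈-applyUpTo⁻ _ (∈-⟦⟧⁻ (orbit x d y) g∈O) =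
    subst (T ∘ ⟦ orbit x d y ⟧) (assoc x (j · x) y) (∈-⟦⟧⁺ next)
    where
      next : ((suc j · x) ⊕ y) ∈ orbit x d y
      next with ℕ.m≤n⇒m<n∨m≡n j<d
      ... | inj₁ 1+j<d = ∈-applyUpTo⁺ _ 1+j<d
      ... | inj₂ 1+j≡d = subst (_∈ orbit x d y) (begin
        (0 · x) ⊕ y      ≡⟨ cong (_⊕ y) d·x≡0 ⟨
        (d · x) ⊕ y      ≡⟨ cong (λ m → (m · x) ⊕ y) 1+j≡d ⟨
        (suc j · x) ⊕ y  ∎) (∈-applyUpTo⁺ _ 0<d)
        where open ≡-Reasoning

  orbit⊆ : ∀ {x n y X} → Periodic x X → y ∈ₛ X → ⟦ orbit x n y ⟧ ⊆ X
  orbit⊆ {x} {n} {y} {X} x-periodic y∈X g g∈O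
    with j , _ , refl ← ∈-applyUpTo⁻ _ (∈-⟦⟧⁻ (orbit x n y) g∈O) = Periodic-· {X = X} x-periodic j y∈X

  Periodic-⊖ : ∀ {d x X} → HasOrder d x → Periodic x X → Periodic (⊖ x) X
  Periodic-⊖ {suc d} {x} {X} (_ , 1+d·x≡0 , _) x-periodic =
    subst (λ z → Periodic z X) (inverseʳ-unique x (d · x) 1+d·x≡0) (Periodic-· {X = X} x-periodic d)

  Periodic-∖ : ∀ {x X Y} → Periodic x X → Periodic (⊖ x) Y → Periodic x (X ∖ Y)
  Periodic-∖ {x} {X} {Y} x-periodic ⊖x-periodic {g} g∈X∖Y with g∈X , g∉Y ← ∈-∖⁻ X Y g∈X∖Y =
    ∈-∖⁺ {X} {Y} (x-periodic g∈X) (λ x+g∈Y → g∉Y (subst (T ∘ Y) (\\-leftDividesʳ x g) (⊖x-periodic x+g∈Y)))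

  ∣∖orbit∣+d≡∣∣ : ∀ {d x y X} → HasOrder d x → Periodic x X → y ∈ₛ X →
                   ∣ X ∖ ⟦ orbit x d y ⟧ ∣ + d ≡ ∣ X ∣
  ∣∖orbit∣+d≡∣∣ {d} {x} {y} {X} x-order x-periodic y∈X = begin
    ∣ X ∖ O ∣ + d          ≡⟨ cong (∣ X ∖ O ∣ +_) ∣O∣≡d ⟨
    ∣ X ∖ O ∣ + ∣ O ∣      ≡⟨ cong (∣ X ∖ O ∣ +_) ∣X∩O∣≡∣O∣ ⟨
    ∣ X ∖ O ∣ + ∣ X ∩ O ∣  ≡⟨ ∣∖∣+∣∩∣ X O ⟩
    ∣ X ∣                  ∎
    where
      open ≡-Reasoning
      O : Subset
      O = ⟦ orbit x d y ⟧
      ∣O∣≡d : ∣ O ∣ ≡ d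
      ∣O∣≡d = trans (∣⟦⟧∣ (orbit-unique y (proj₂ (proj₂ x-order)))) (length-applyUpTo _ d)
      ∣X∩O∣≡∣O∣ : ∣ X ∩ O ∣ ≡ ∣ O ∣
      ∣X∩O∣≡∣O∣ = ℕ.≤-antisym
        (∣∣-mono (λ g → proj₂ ∘ ∈-∩⁻ X O))
        (∣∣-mono (λ g g∈O → ∈-∩⁺ {X} {O} (orbit⊆ {n = d} {X = X} x-periodic y∈X g g∈O) g∈O))

  HasOrder⇒∣∣periodic∣ : ∀ {d x} → HasOrder d x → ∀ n X → Periodic x X → ∣ X ∣ ≤ n → d ∣ ∣ X ∣
  HasOrder⇒∣∣periodic∣ {d} _ zero X _ ∣X∣≤0 = subst (d ∣_) (sym (ℕ.n≤0⇒n≡0 ∣X∣≤0)) (d ∣0)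
  HasOrder⇒∣∣periodic∣ {d} {x} x-order (suc n) X x-periodic ∣X∣≤1+n with search (T? ∘ X)
  ... | inj₂ X-empty = subst (d ∣_) (sym (∣∣-empty X-empty)) (d ∣0)
  ... | inj₁ (y , y∈X) = subst (d ∣_) (∣∖orbit∣+d≡∣∣ x-order x-periodic y∈X) (∣m∣n⇒∣m+n d∣∣X∖O∣ ∣-refl)
    where
      O : Subset
      O = ⟦ orbit x d y ⟧
      ∣X∖O∣≤n : ∣ X ∖ O ∣ ≤ n
      ∣X∖O∣≤n = ℕ.≤-pred (begin-strict
        ∣ X ∖ O ∣      <⟨ ℕ.m<m+n (∣ X ∖ O ∣) (proj₁ x-order) ⟩
        ∣ X ∖ O ∣ + d  ≡⟨ ∣∖orbit∣+d≡∣∣ x-order x-periodic y∈X ⟩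
        ∣ X ∣          ≤⟨ ∣X∣≤1+n ⟩
        suc n          ∎)
        where open ≤-Reasoning
      d∣∣X∖O∣ : d ∣ ∣ X ∖ O ∣
      d∣∣X∖O∣ = HasOrder⇒∣∣periodic∣ x-order n (X ∖ O)
        (Periodic-∖ {X = X} {O} x-periodic (Periodic-⊖ {X = O} x-order (orbit-periodic y x-order))) ∣X∖O∣≤n

  HasOrder⇒∣order : ∀ {d x} → HasOrder d x → d ∣ order
  HasOrder⇒∣order x-order = HasOrder⇒∣∣periodic∣ x-order order (λ _ → true) _ ≤-refl

  OrderAtLeast-leastPrimeDivisor : ∀ {p x} → (∀ q → Prime q → q ∣ order → p ≤ q) → x ≢ 𝟘 → OrderAtLeast p x
  OrderAtLeast-leastPrimeDivisor {p} {x} p-least x≢0 {j} 0<j j<p j·x≡0 with order-exists x j 0<j j·x≡0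
  ... | suc zero , _ , _ , x⊕0≡0 , _ = x≢0 (trans (sym (identityʳ x)) x⊕0≡0)
  ... | d@(suc (suc _)) , d≤j , x-order =
    ℕ.<⇒≱ j<p (≤-trans (least-prime-divisor≤ p-least (s≤s (s≤s z≤n)) (HasOrder⇒∣order x-order)) d≤j)

  -- Self-intersections of translates

  ⊆+ₜ⇒Periodic : ∀ {A y} → A ⊆ (y +ₜ A) → Periodic y A × Periodic (⊖ y) A
  ⊆+ₜ⇒Periodic {A} {y} A⊆y+A = (λ {a} a∈A → y+A⊆A (y ⊕ a) (∈-+ₜ⁺ y a∈A)) , -y+A⊆A
    where
      y+A⊆A : (y +ₜ A) ⊆ A
      y+A⊆A = ⊆∧∣∣≤⇒⊇ A⊆y+A (ℕ.≤-reflexive (∣+ₜ∣ y A))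
      -y+A⊆A : Periodic (⊖ y) A
      -y+A⊆A {g} g∈A with a , a∈A , refl ← ∈-+ₜ⁻ A y (A⊆y+A g g∈A) =
        subst (T ∘ A) (sym (\\-leftDividesʳ y a)) a∈A

  Periodic⇒∣∩+ₜ∣≥ : ∀ {n x A a} → OrderAtLeast n x → Periodic x A → 𝟘 ∈ₛ A → a ∈ₛ A → n ≤ ∣ A ∩ (a +ₜ A) ∣
  Periodic⇒∣∩+ₜ∣≥ {n} {x} {A} {a} x-order≥n x-periodic 0∈A a∈A = begin
    n                       ≡⟨ length-applyUpTo _ n ⟨
    length (orbit x n a)    ≤⟨ length≤∣∣ (orbit-unique a x-order≥n) orbit⊆A∩a+A ⟩
    ∣ A ∩ (a +ₜ A) ∣        ∎
    where
      open ≤-Reasoning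
      orbit⊆A∩a+A : ∀ {g} → g ∈ orbit x n a → g ∈ₛ (A ∩ (a +ₜ A))
      orbit⊆A∩a+A g∈orbit with j , _ , refl ← ∈-applyUpTo⁻ _ g∈orbit =
        ∈-∩⁺ {A} {a +ₜ A} (Periodic-· {X = A} x-periodic j a∈A)
          (subst (T ∘ (a +ₜ A)) (comm a (j · x))
            (∈-+ₜ⁺ a (subst (T ∘ A) (identityʳ (j · x)) (Periodic-· {X = A} x-periodic j 0∈A))))

  ∣∩+ₜ∣≤1⇒IsSidon : ∀ {A} → (∀ x → x ≢ 𝟘 → ∣ A ∩ (x +ₜ A) ∣ ≤ 1) → IsSidon A
  ∣∩+ₜ∣≤1⇒IsSidon {A} small a b c d a∈A b∈A c∈A d∈A a+b≡c+d with (a ⊕ (⊖ c)) ≟ 𝟘 | a ≟ d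
  ... | yes a-c≡0 | _ = inj₁ (a≡c , ∙-cancelˡ a b d (trans a+b≡c+d (cong (_⊕ d) (sym a≡c))))
    where
      a≡c : a ≡ c
      a≡c = x∙y⁻¹≈ε⇒x≈y a c a-c≡0
  ... | no _ | yes a≡d =
    inj₂ (a≡d , ∙-cancelˡ a b c (trans a+b≡c+d (trans (comm c d) (cong (_⊕ c) (sym a≡d)))))
  ... | no a-c≢0 | no a≢d = ⊥-elim (ℕ.<⇒≱ 2≤∣∩∣ (small (a ⊕ (⊖ c)) a-c≢0))
    where
      x : Carrier
      x = a ⊕ (⊖ c)
      x+b≡d : x ⊕ b ≡ d
      x+b≡d = begin
        (a ⊕ (⊖ c)) ⊕ b  ≡⟨ assoc a (⊖ c) b ⟩
        a ⊕ ((⊖ c) ⊕ b)  ≡⟨ cong (a ⊕_) (comm (⊖ c) b) ⟩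
        a ⊕ (b ⊕ (⊖ c))  ≡⟨ assoc a b (⊖ c) ⟨
        (a ⊕ b) ⊕ (⊖ c)  ≡⟨ cong (_⊕ (⊖ c)) (trans a+b≡c+d (comm c d)) ⟩
        (d ⊕ c) ⊕ (⊖ c)  ≡⟨ //-rightDividesʳ c d ⟩
        d                ∎
        where open ≡-Reasoning
      a,d∈A∩x+A : ∀ {g} → g ∈ (a ∷ d ∷ []) → g ∈ₛ (A ∩ (x +ₜ A))
      a,d∈A∩x+A (here refl) =
        ∈-∩⁺ {A} {x +ₜ A} a∈A (subst (T ∘ (x +ₜ A)) (//-rightDividesˡ c a) (∈-+ₜ⁺ x c∈A))
      a,d∈A∩x+A (there (here refl)) =
        ∈-∩⁺ {A} {x +ₜ A} d∈A (subst (T ∘ (x +ₜ A)) x+b≡d (∈-+ₜ⁺ x b∈A))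
      2≤∣∩∣ : 2 ≤ ∣ A ∩ (x +ₜ A) ∣
      2≤∣∩∣ = length≤∣∣ ((a≢d ∷ []) ∷ [] ∷ []) a,d∈A∩x+A

  +ₜ⊆ : ∀ {H A y} → IsSubgroup H → y ∈ₛ H → A ⊆ H → (y +ₜ A) ⊆ H
  +ₜ⊆ {H} {A} {y} (_ , H-+ , _) y∈H A⊆H g g∈y+A with a , a∈A , refl ← ∈-+ₜ⁻ A y g∈y+A =
    H-+ y a y∈H (A⊆H a a∈A)

  ∩+ₜ-nonempty⇒∈ : ∀ {H A y g} → IsSubgroup H → A ⊆ H → g ∈ₛ (A ∩ (y +ₜ A)) → y ∈ₛ H
  ∩+ₜ-nonempty⇒∈ {H} {A} {y} (_ , H-+ , H-⊖) A⊆H g∈A∩y+A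
    with g∈A , g∈y+A ← ∈-∩⁻ A (y +ₜ A) g∈A∩y+A
    with a , a∈A , refl ← ∈-+ₜ⁻ A y g∈y+A =
    subst (T ∘ H) (//-rightDividesʳ a y) (H-+ (y ⊕ a) (⊖ a) (A⊆H _ g∈A) (H-⊖ a (A⊆H a a∈A)))

  -- The function κ and its atoms

  module Atoms (k : ℕ) (S H : Subset) (0∈S : 𝟘 ∈ₛ S) (H-subgroup : IsSubgroup H) (S⊆H : S ⊆ H) where

    κ : Subset → ℕ
    κ X = ∣ X +ₛ S ∣ ∸ ∣ X ∣

    ⊆+ₛ : ∀ X → X ⊆ (X +ₛ S)
    ⊆+ₛ X g g∈X = subst (T ∘ (X +ₛ S)) (identityʳ g) (∈-+ₛ⁺ {X} {S} g∈X 0∈S)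

    ∣+ₛ∣ : ∀ X → ∣ X +ₛ S ∣ ≡ κ X + ∣ X ∣
    ∣+ₛ∣ X = sym (ℕ.m∸n+n≡m (∣∣-mono (⊆+ₛ X)))

    +ₛ-mono : ∀ {X Y} → X ⊆ Y → (X +ₛ S) ⊆ (Y +ₛ S)
    +ₛ-mono {X} {Y} X⊆Y g g∈X+S with x , s , x∈X , s∈S , refl ← ∈-+ₛ⁻ X S g∈X+S =
      ∈-+ₛ⁺ {Y} {S} (X⊆Y x x∈X) s∈S

    +ₛ⊆H : ∀ {X} → X ⊆ H → (X +ₛ S) ⊆ H
    +ₛ⊆H {X} X⊆H g g∈X+S with x , s , x∈X , s∈S , refl ← ∈-+ₛ⁻ X S g∈X+S =
      proj₁ (proj₂ H-subgroup) x s (X⊆H x x∈X) (S⊆H s s∈S)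

    ∣+ₛ∣-submodular : ∀ X Y → ∣ (X ∩ Y) +ₛ S ∣ + ∣ (X ∪ Y) +ₛ S ∣ ≤ ∣ X +ₛ S ∣ + ∣ Y +ₛ S ∣
    ∣+ₛ∣-submodular X Y = begin
      ∣ (X ∩ Y) +ₛ S ∣ + ∣ (X ∪ Y) +ₛ S ∣                  ≤⟨ ℕ.+-mono-≤ (∣∣-mono ∩+ₛ⊆) (∣∣-mono ∪+ₛ⊆) ⟩
      ∣ (X +ₛ S) ∩ (Y +ₛ S) ∣ + ∣ (X +ₛ S) ∪ (Y +ₛ S) ∣  ≡⟨ ∣∩∣+∣∪∣ (X +ₛ S) (Y +ₛ S) ⟩
      ∣ X +ₛ S ∣ + ∣ Y +ₛ S ∣                              ∎
      where
        open ≤-Reasoning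
        ∩+ₛ⊆ : ((X ∩ Y) +ₛ S) ⊆ ((X +ₛ S) ∩ (Y +ₛ S))
        ∩+ₛ⊆ g g∈[X∩Y]+S = ∈-∩⁺ {X +ₛ S} {Y +ₛ S}
          (+ₛ-mono (λ _ → proj₁ ∘ ∈-∩⁻ X Y) g g∈[X∩Y]+S) (+ₛ-mono (λ _ → proj₂ ∘ ∈-∩⁻ X Y) g g∈[X∩Y]+S)
        ∪+ₛ⊆ : ((X ∪ Y) +ₛ S) ⊆ ((X +ₛ S) ∪ (Y +ₛ S))
        ∪+ₛ⊆ g g∈[X∪Y]+S with x , s , x∈X∪Y , s∈S , refl ← ∈-+ₛ⁻ (X ∪ Y) S g∈[X∪Y]+S with ∈-∪⁻ X Y x∈X∪Y
        ... | inj₁ x∈X = ∈-∪⁺ˡ {X +ₛ S} {Y +ₛ S} (∈-+ₛ⁺ {X} {S} x∈X s∈S)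
        ... | inj₂ x∈Y = ∈-∪⁺ʳ {X +ₛ S} {Y +ₛ S} (∈-+ₛ⁺ {Y} {S} x∈Y s∈S)

    κ-submodular : ∀ X Y → κ (X ∩ Y) + κ (X ∪ Y) ≤ κ X + κ Y
    κ-submodular X Y = ℕ.+-cancelʳ-≤ (∣ X ∣ + ∣ Y ∣) _ _ (begin
      (κ (X ∩ Y) + κ (X ∪ Y)) + (∣ X ∣ + ∣ Y ∣)          ≡⟨ cong (κ (X ∩ Y) + κ (X ∪ Y) +_) (∣∩∣+∣∪∣ X Y) ⟨
      (κ (X ∩ Y) + κ (X ∪ Y)) + (∣ X ∩ Y ∣ + ∣ X ∪ Y ∣)  ≡⟨ interchange (κ (X ∩ Y)) _ _ _ ⟩
      (κ (X ∩ Y) + ∣ X ∩ Y ∣) + (κ (X ∪ Y) + ∣ X ∪ Y ∣)  ≡⟨ cong₂ _+_ (∣+ₛ∣ (X ∩ Y)) (∣+ₛ∣ (X ∪ Y)) ⟨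
      ∣ (X ∩ Y) +ₛ S ∣ + ∣ (X ∪ Y) +ₛ S ∣                ≤⟨ ∣+ₛ∣-submodular X Y ⟩
      ∣ X +ₛ S ∣ + ∣ Y +ₛ S ∣                            ≡⟨ cong₂ _+_ (∣+ₛ∣ X) (∣+ₛ∣ Y) ⟩
      (κ X + ∣ X ∣) + (κ Y + ∣ Y ∣)                      ≡⟨ interchange (κ X) _ _ _ ⟩
      (κ X + κ Y) + (∣ X ∣ + ∣ Y ∣)                      ∎)
      where open ≤-Reasoning

    κ-+ₜ : ∀ y X → κ (y +ₜ X) ≡ κ X
    κ-+ₜ y X = cong₂ _∸_ ∣[y+X]+S∣≡∣X+S∣ (∣+ₜ∣ y X)
      where
        X+S⊆-y+[[y+X]+S] : ∀ {g} → g ∈ₛ (X +ₛ S) → (y ⊕ g) ∈ₛ ((y +ₜ X) +ₛ S)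
        X+S⊆-y+[[y+X]+S] g∈X+S with x , s , x∈X , s∈S , refl ← ∈-+ₛ⁻ X S g∈X+S =
          subst (T ∘ ((y +ₜ X) +ₛ S)) (assoc y x s) (∈-+ₛ⁺ {y +ₜ X} {S} (∈-+ₜ⁺ y x∈X) s∈S)
        -y+[[y+X]+S]⊆X+S : ∀ {g} → g ∈ₛ ((y +ₜ X) +ₛ S) → ((⊖ y) ⊕ g) ∈ₛ (X +ₛ S)
        -y+[[y+X]+S]⊆X+S g∈[y+X]+S with b , s , b∈y+X , s∈S , refl ← ∈-+ₛ⁻ (y +ₜ X) S g∈[y+X]+S
          with x , x∈X , refl ← ∈-+ₜ⁻ X y b∈y+X =
          subst (T ∘ (X +ₛ S)) (begin
            x ⊕ s                  ≡⟨ cong (_⊕ s) (\\-leftDividesʳ y x) ⟨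
            ((⊖ y) ⊕ (y ⊕ x)) ⊕ s  ≡⟨ assoc (⊖ y) (y ⊕ x) s ⟩
            (⊖ y) ⊕ ((y ⊕ x) ⊕ s)  ∎) (∈-+ₛ⁺ {X} {S} x∈X s∈S)
          where open ≡-Reasoning
        ∣[y+X]+S∣≡∣X+S∣ : ∣ (y +ₜ X) +ₛ S ∣ ≡ ∣ X +ₛ S ∣
        ∣[y+X]+S∣≡∣X+S∣ = sym (∣∣-translate y X+S⊆-y+[[y+X]+S] -y+[[y+X]+S]⊆X+S)

    dual : Subset → Subset
    dual X = ⊖ₛ (H ∖ (X +ₛ S))

    dual⊆H : ∀ X → dual X ⊆ H
    dual⊆H X g g∈dual = subst (T ∘ H) (⁻¹-involutive g)
      (proj₂ (proj₂ H-subgroup) (⊖ g) (proj₁ (∈-∖⁻ H (X +ₛ S) g∈dual)))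

    ∣dual∣+∣+ₛ∣ : ∀ {X} → X ⊆ H → ∣ dual X ∣ + ∣ X +ₛ S ∣ ≡ ∣ H ∣
    ∣dual∣+∣+ₛ∣ {X} X⊆H = begin
      ∣ dual X ∣ + ∣ X +ₛ S ∣              ≡⟨ cong₂ _+_ (∣⊖ₛ∣ (H ∖ (X +ₛ S))) ∣X+S∣≡∣H∩[X+S]∣ ⟩
      ∣ H ∖ (X +ₛ S) ∣ + ∣ H ∩ (X +ₛ S) ∣  ≡⟨ ∣∖∣+∣∩∣ H (X +ₛ S) ⟩
      ∣ H ∣                                ∎
      where
        open ≡-Reasoning
        ∣X+S∣≡∣H∩[X+S]∣ : ∣ X +ₛ S ∣ ≡ ∣ H ∩ (X +ₛ S) ∣
        ∣X+S∣≡∣H∩[X+S]∣ = ℕ.≤-antisym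
          (∣∣-mono (λ g g∈X+S → ∈-∩⁺ {H} {X +ₛ S} (+ₛ⊆H X⊆H g g∈X+S) g∈X+S))
          (∣∣-mono (λ _ → proj₂ ∘ ∈-∩⁻ H (X +ₛ S)))

    ∣dual+ₛ∣+∣∣≤∣H∣ : ∀ {X} → X ⊆ H → ∣ dual X +ₛ S ∣ + ∣ X ∣ ≤ ∣ H ∣
    ∣dual+ₛ∣+∣∣≤∣H∣ {X} X⊆H = begin
      ∣ dual X +ₛ S ∣ + ∣ X ∣     ≡⟨ cong (∣ dual X +ₛ S ∣ +_) (∣⊖ₛ∣ X) ⟨
      ∣ dual X +ₛ S ∣ + ∣ ⊖ₛ X ∣  ≤⟨ ∣∣-disjoint (+ₛ⊆H (dual⊆H X)) ⊖X⊆H disjoint ⟩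
      ∣ H ∣                       ∎
      where
        open ≤-Reasoning
        ⊖X⊆H : (⊖ₛ X) ⊆ H
        ⊖X⊆H g g∈⊖X = subst (T ∘ H) (⁻¹-involutive g) (proj₂ (proj₂ H-subgroup) (⊖ g) (X⊆H (⊖ g) g∈⊖X))
        disjoint : ∀ g → g ∈ₛ (dual X +ₛ S) → ¬ g ∈ₛ (⊖ₛ X)
        disjoint g g∈dual+S ⊖g∈X with z , s , z∈dual , s∈S , refl ← ∈-+ₛ⁻ (dual X) S g∈dual+S =
          proj₂ (∈-∖⁻ H (X +ₛ S) z∈dual)
            (subst (T ∘ (X +ₛ S)) ⊖[z+s]+s≡⊖z (∈-+ₛ⁺ {X} {S} ⊖g∈X s∈S))
          where
            ⊖[z+s]+s≡⊖z : (⊖ (z ⊕ s)) ⊕ s ≡ ⊖ z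
            ⊖[z+s]+s≡⊖z = trans (cong (_⊕ s) (sym (⁻¹-∙-comm z s))) (//-rightDividesˡ s (⊖ z))

    κ-dual : ∀ {X} → X ⊆ H → κ (dual X) ≤ κ X
    κ-dual {X} X⊆H = ℕ.+-cancelʳ-≤ (∣ dual X ∣ + ∣ X ∣) _ _ (begin
      κ (dual X) + (∣ dual X ∣ + ∣ X ∣)  ≡⟨ ℕ.+-assoc (κ (dual X)) _ _ ⟨
      (κ (dual X) + ∣ dual X ∣) + ∣ X ∣  ≡⟨ cong (_+ ∣ X ∣) (∣+ₛ∣ (dual X)) ⟨
      ∣ dual X +ₛ S ∣ + ∣ X ∣            ≤⟨ ∣dual+ₛ∣+∣∣≤∣H∣ X⊆H ⟩
      ∣ H ∣                              ≡⟨ ∣dual∣+∣+ₛ∣ X⊆H ⟨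
      ∣ dual X ∣ + ∣ X +ₛ S ∣            ≡⟨ cong (∣ dual X ∣ +_) (∣+ₛ∣ X) ⟩
      ∣ dual X ∣ + (κ X + ∣ X ∣)         ≡⟨ x∙yz≈y∙xz (∣ dual X ∣) (κ X) (∣ X ∣) ⟩
      κ X + (∣ dual X ∣ + ∣ X ∣)         ∎)
      where open ≤-Reasoning

    dual-admissible : ∀ {X} → Admissible k S H X → Admissible k S H (dual X)
    dual-admissible {X} (X⊆H , k≤∣X∣ , ∣X+S∣+k≤∣H∣) = dual⊆H X , k≤∣dual∣ , (begin
      ∣ dual X +ₛ S ∣ + k      ≤⟨ ℕ.+-monoʳ-≤ (∣ dual X +ₛ S ∣) k≤∣X∣ ⟩
      ∣ dual X +ₛ S ∣ + ∣ X ∣  ≤⟨ ∣dual+ₛ∣+∣∣≤∣H∣ X⊆H ⟩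
      ∣ H ∣                    ∎)
      where
        open ≤-Reasoning
        k≤∣dual∣ : k ≤ ∣ dual X ∣
        k≤∣dual∣ = ℕ.+-cancelˡ-≤ (∣ X +ₛ S ∣) k (∣ dual X ∣) (begin
          ∣ X +ₛ S ∣ + k           ≤⟨ ∣X+S∣+k≤∣H∣ ⟩
          ∣ H ∣                    ≡⟨ ∣dual∣+∣+ₛ∣ X⊆H ⟨
          ∣ dual X ∣ + ∣ X +ₛ S ∣  ≡⟨ ℕ.+-comm (∣ dual X ∣) _ ⟩
          ∣ X +ₛ S ∣ + ∣ dual X ∣  ∎)

    fragment-by-κ : ∀ {A X} → IsFragment k S H A → Admissible k S H X → κ X ≤ κ A → IsFragment k S H X
    fragment-by-κ (_ , A-minimises) X-admissible κX≤κA =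
      X-admissible , λ Y Y-admissible → ≤-trans κX≤κA (A-minimises Y Y-admissible)

    ∣∣+∣+ₛ∣≤∣H∣ : ∀ {A} → IsAtom k S H A → ∣ A ∣ + ∣ A +ₛ S ∣ ≤ ∣ H ∣
    ∣∣+∣+ₛ∣≤∣H∣ {A} (A-fragment@(A-admissible@(A⊆H , _) , _) , A-smallest) = begin
      ∣ A ∣ + ∣ A +ₛ S ∣       ≤⟨ ℕ.+-monoˡ-≤ (∣ A +ₛ S ∣) (A-smallest (dual A) dual-fragment) ⟩
      ∣ dual A ∣ + ∣ A +ₛ S ∣  ≡⟨ ∣dual∣+∣+ₛ∣ A⊆H ⟩
      ∣ H ∣                    ∎
      where
        open ≤-Reasoning
        dual-fragment : IsFragment k S H (dual A)
        dual-fragment = fragment-by-κ A-fragment (dual-admissible A-admissible) (κ-dual A⊆H)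

    ∣∪+ₛ∣+k≤∣H∣ : ∀ {A B} → IsAtom k S H A → ∣ B ∣ ≡ ∣ A ∣ → κ (A ∪ B) ≤ κ A → k ≤ ∣ A ∩ B ∣ →
                  ∣ (A ∪ B) +ₛ S ∣ + k ≤ ∣ H ∣
    ∣∪+ₛ∣+k≤∣H∣ {A} {B} A-atom ∣B∣≡∣A∣ κ∪≤κA k≤∣A∩B∣ = begin
      ∣ (A ∪ B) +ₛ S ∣ + k           ≡⟨ cong (_+ k) (∣+ₛ∣ (A ∪ B)) ⟩
      (κ (A ∪ B) + ∣ A ∪ B ∣) + k    ≤⟨ ℕ.+-mono-≤ (ℕ.+-monoˡ-≤ (∣ A ∪ B ∣) κ∪≤κA) k≤∣A∩B∣ ⟩
      (κ A + ∣ A ∪ B ∣) + ∣ A ∩ B ∣  ≡⟨ ℕ.+-assoc (κ A) _ _ ⟩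
      κ A + (∣ A ∪ B ∣ + ∣ A ∩ B ∣)  ≡⟨ cong (κ A +_) (trans (ℕ.+-comm (∣ A ∪ B ∣) _) (∣∩∣+∣∪∣ A B)) ⟩
      κ A + (∣ A ∣ + ∣ B ∣)          ≡⟨ cong (λ m → κ A + (∣ A ∣ + m)) ∣B∣≡∣A∣ ⟩
      κ A + (∣ A ∣ + ∣ A ∣)          ≡⟨ ℕ.+-assoc (κ A) _ _ ⟨
      (κ A + ∣ A ∣) + ∣ A ∣          ≡⟨ cong (_+ ∣ A ∣) (∣+ₛ∣ A) ⟨
      ∣ A +ₛ S ∣ + ∣ A ∣             ≡⟨ ℕ.+-comm _ (∣ A ∣) ⟩
      ∣ A ∣ + ∣ A +ₛ S ∣             ≤⟨ ∣∣+∣+ₛ∣≤∣H∣ A-atom ⟩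
      ∣ H ∣                          ∎
      where open ≤-Reasoning

    atom⊆ : ∀ {A B} → IsAtom k S H A → B ⊆ H → ∣ B ∣ ≡ ∣ A ∣ → κ B ≡ κ A → k ≤ ∣ A ∩ B ∣ → A ⊆ B
    atom⊆ {A} {B} A-atom@(A-fragment@(A-admissible@(A⊆H , k≤∣A∣ , ∣A+S∣+k≤∣H∣) , A-minimises) , A-smallest)
          B⊆H ∣B∣≡∣A∣ κB≡κA k≤∣A∩B∣ g = proj₂ ∘ ∈-∩⁻ A B ∘ A⊆A∩B g
      where
        A∩B⊆A : (A ∩ B) ⊆ A
        A∩B⊆A _ = proj₁ ∘ ∈-∩⁻ A B
        A∩B-admissible : Admissible k S H (A ∩ B)
        A∩B-admissible = (λ g → A⊆H g ∘ A∩B⊆A g) , k≤∣A∩B∣ ,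
          ≤-trans (ℕ.+-monoˡ-≤ k (∣∣-mono (+ₛ-mono A∩B⊆A))) ∣A+S∣+k≤∣H∣
        κ∩+κ∪≤κA+κA : κ (A ∩ B) + κ (A ∪ B) ≤ κ A + κ A
        κ∩+κ∪≤κA+κA = subst (λ m → κ (A ∩ B) + κ (A ∪ B) ≤ κ A + m) κB≡κA (κ-submodular A B)
        κ∪≤κA : κ (A ∪ B) ≤ κ A
        κ∪≤κA = a≤m∧m+n≤a+a⇒n≤a (A-minimises (A ∩ B) A∩B-admissible) κ∩+κ∪≤κA+κA
        A∪B-admissible : Admissible k S H (A ∪ B)
        A∪B-admissible = (λ g g∈A∪B → [ A⊆H g , B⊆H g ]′ (∈-∪⁻ A B g∈A∪B)) ,
          ≤-trans k≤∣A∣ (∣∣-mono (λ _ → ∈-∪⁺ˡ {A} {B})) , ∣∪+ₛ∣+k≤∣H∣ A-atom ∣B∣≡∣A∣ κ∪≤κA k≤∣A∩B∣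
        κ∩≤κA : κ (A ∩ B) ≤ κ A
        κ∩≤κA = a≤m∧m+n≤a+a⇒n≤a (A-minimises (A ∪ B) A∪B-admissible)
          (subst (_≤ κ A + κ A) (ℕ.+-comm (κ (A ∩ B)) _) κ∩+κ∪≤κA+κA)
        A⊆A∩B : A ⊆ (A ∩ B)
        A⊆A∩B = ⊆∧∣∣≤⇒⊇ A∩B⊆A (A-smallest (A ∩ B) (fragment-by-κ A-fragment A∩B-admissible κ∩≤κA))

    atom-periodic : ∀ {A y} → 1 ≤ k → IsAtom k S H A → k ≤ ∣ A ∩ (y +ₜ A) ∣ → Periodic y A × Periodic (⊖ y) A
    atom-periodic {A} {y} 1≤k A-atom k≤∣A∩y+A∣ =
      ⊆+ₜ⇒Periodic (atom⊆ A-atom (+ₜ⊆ H-subgroup y∈H A⊆H) (∣+ₜ∣ y A) (κ-+ₜ y A) k≤∣A∩y+A∣)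
      where
        A⊆H : A ⊆ H
        A⊆H = proj₁ (proj₁ (proj₁ A-atom))
        y∈H : y ∈ₛ H
        y∈H = ∩+ₜ-nonempty⇒∈ H-subgroup A⊆H (proj₂ (∣∣>0⇒nonempty (≤-trans 1≤k k≤∣A∩y+A∣)))

    atom-subgroup : ∀ {A x n} → 1 ≤ k → k ≤ n → IsAtom k S H A → 𝟘 ∈ₛ A → OrderAtLeast n x →
                    k ≤ ∣ A ∩ (x +ₜ A) ∣ → IsSubgroup A
    atom-subgroup {A} {x} 1≤k k≤n A-atom 0∈A x-order≥n k≤∣A∩x+A∣ =
      0∈A , (λ a b a∈A → proj₁ (periodic a∈A)) ,
      (λ a a∈A → subst (T ∘ A) (identityʳ (⊖ a)) (proj₂ (periodic a∈A) 0∈A))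
      where
        x-periodic : Periodic x A
        x-periodic = proj₁ (atom-periodic 1≤k A-atom k≤∣A∩x+A∣)
        periodic : ∀ {a} → a ∈ₛ A → Periodic a A × Periodic (⊖ a) A
        periodic a∈A = atom-periodic 1≤k A-atom (≤-trans k≤n (Periodic⇒∣∩+ₜ∣≥ x-order≥n x-periodic 0∈A a∈A))

    atom-dichotomy : ∀ {A p} → 1 ≤ k → k ≤ p → (∀ q → Prime q → q ∣ order → p ≤ q) → IsAtom k S H A → 𝟘 ∈ₛ A →
                     IsSubgroup A ⊎ (∀ x → x ≢ 𝟘 → ∣ A ∩ (x +ₜ A) ∣ ≤ k ∸ 1)
    atom-dichotomy {A} 1≤k k≤p p-least A-atom 0∈A with search (λ x → ¬? (x ≟ 𝟘) ×-dec k ≤? ∣ A ∩ (x +ₜ A) ∣)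
    ... | inj₁ (x , x≢0 , k≤∣A∩x+A∣) =
      inj₁ (atom-subgroup 1≤k k≤p A-atom 0∈A (OrderAtLeast-leastPrimeDivisor p-least x≢0) k≤∣A∩x+A∣)
    ... | inj₂ none = inj₂ λ x x≢0 → ℕ.<⇒≤pred (ℕ.≰⇒> (λ k≤∣A∩x+A∣ → none x (x≢0 , k≤∣A∩x+A∣)))

open Defs

corollary2p6 : (G : FiniteAbelianGroup) → (k : ℕ) → k ≥ 1 →
    (S H A : Subset G) → _∈ₛ_ G (FiniteAbelianGroup.𝟘 G) S →
    IsGeneratedBy G S H → IsSeparable G k S H →
    IsAtom G k S H A → _∈ₛ_ G (FiniteAbelianGroup.𝟘 G) A →
    (p : ℕ) → Prime p → p ∣ order G →
    (∀ q → Prime q → q ∣ order G → p ≤ q) → p ≥ k →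
    (IsSubgroup G A
      ⊎ (∀ x → x ≢ FiniteAbelianGroup.𝟘 G →
           ∣_∣ G (_∩_ G A (_+ₜ_ G x A)) ≤ k ∸ 1))
    × (k ≡ 2 → IsSubgroup G A ⊎ IsSidon G A)
-- Separability is implied by the existence of the atom, and of p only its minimality
-- among the prime divisors of |G| is needed.
corollary2p6 G k 1≤k S H A 0∈S (H-subgroup , S⊆H , _) _ A-atom 0∈A p _ _ p-least k≤p =
  dichotomy , λ k≡2 → Sum.map₂ (sidon k≡2) dichotomy
  where
    open Properties G using (∣∩+ₜ∣≤1⇒IsSidon)
    open Properties.Atoms G k S H 0∈S H-subgroup S⊆H using (atom-dichotomy)
    SmallSelfIntersections : Set
    SmallSelfIntersections = ∀ x → x ≢ FiniteAbelianGroup.𝟘 G → ∣_∣ G (_∩_ G A (_+ₜ_ G x A)) ≤ k ∸ 1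
    dichotomy : IsSubgroup G A ⊎ SmallSelfIntersections
    dichotomy = atom-dichotomy 1≤k k≤p p-least A-atom 0∈A
    sidon : k ≡ 2 → SmallSelfIntersections → IsSidon G A
    sidon k≡2 small = ∣∩+ₜ∣≤1⇒IsSidon (λ x x≢0 → subst (λ m → _ ≤ m ∸ 1) k≡2 (small x x≢0))
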